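{- Let $G$ be a graph with no isolated vertex. Then the following three properties are equivalent: (1) $G$ has a certified dominating set with no shadowed vertex; (2) $G$ is a $DD_2$-graph; (3) $N_G(s)-(L_G\cup S_G)\neq\emptyset$ for every weak support $s$ of $G$.
   Context: All graphs are finite and simple. $N_G(v)$ is the set of neighbors of $v$, $N_G[v]=N_G(v)\cup\{v\}$. A leaf is a vertex of degree one; its unique neighbor is a support vertex. A support adjacent to at least two leaves is strong, otherwise weak. $L_G$ is the set of leaves and $S_G$ the set of all support vertices of $G$. A set $D\subseteq V_G$ is dominating if every vertex of $V_G-D$ has a neighbor in $D$; it is 2-dominating if every vertex of $V_G-D$ has at least two neighbors in $D$. A $DD_2$-pair in $G$ is a pair $(D,D_2)$ of disjoint subsets of $V_G$ such that $D$ is dominating and $D_2$ is 2-dominating; $G$ is a $DD_2$-graph if it has a $DD_2$-pair. A dominating set $D$ is certified if every vertex in $D$ has either zero or at least two neighbors in $V_G-D$. A vertex $v$ is shadowed with respect to a certified dominating set $D$ if $N_G[v]\subseteq D$. -}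

module Defs where

open import Data.Nat using (ℕ)
open import Data.Bool using (Bool; true; false)
open import Data.Fin using (Fin)
open import Data.Fin.Subset using (Subset; _∈_; _∉_)
open import Data.Product using (Σ; ∃; ∃-syntax; _×_; _,_)
open import Data.Sum using (_⊎_)
open import Data.Empty using (⊥)
open import Relation.Nullary using (¬_)
open import Relation.Binary.PropositionalEquality using (_≡_; _≢_)

record Graph (n : ℕ) : Set where
  field
    adj     : Fin n → Fin n → Bool
    sym     : ∀ u v → adj u v ≡ adj v u
    irrefl  : ∀ v → adj v v ≡ false

module _ {n : ℕ} (G : Graph n) where
  open Graph G

  Nb : Fin n → Fin n → Set
  Nb v u = adj v u ≡ true

  NoIsolated : Set
  NoIsolated = ∀ v → ∃[ u ] Nb v u

  IsLeaf : Fin n → Set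
  IsLeaf v = ∃[ u ] (Nb v u × (∀ w → Nb v w → w ≡ u))

  IsSupport : Fin n → Set
  IsSupport s = ∃[ l ] (IsLeaf l × Nb s l)

  IsStrongSupport : Fin n → Set
  IsStrongSupport s = ∃[ l₁ ] ∃[ l₂ ] (l₁ ≢ l₂ × IsLeaf l₁ × IsLeaf l₂ × Nb s l₁ × Nb s l₂)

  IsWeakSupport : Fin n → Set
  IsWeakSupport s = IsSupport s × ¬ IsStrongSupport s

  Dominating : Subset n → Set
  Dominating D = ∀ v → v ∉ D → ∃[ u ] (u ∈ D × Nb v u)

  TwoDominating : Subset n → Set
  TwoDominating D = ∀ v → v ∉ D →
    ∃[ u ] ∃[ w ] (u ≢ w × u ∈ D × w ∈ D × Nb v u × Nb v w)

  Disjoint : Subset n → Subset n → Set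
  Disjoint A B = ∀ v → v ∈ A → v ∈ B → ⊥

  DD2Pair : Subset n → Subset n → Set
  DD2Pair D D₂ = Disjoint D D₂ × Dominating D × TwoDominating D₂

  IsDD2Graph : Set
  IsDD2Graph = ∃[ D ] ∃[ D₂ ] DD2Pair D D₂

  Certified : Subset n → Set
  Certified D = Dominating D × (∀ v → v ∈ D →
    (∀ u → Nb v u → u ∈ D)
    ⊎ (∃[ u ] ∃[ w ] (u ≢ w × u ∉ D × w ∉ D × Nb v u × Nb v w)))

  Shadowed : Subset n → Fin n → Set
  Shadowed D v = v ∈ D × (∀ u → Nb v u → u ∈ D)

  Prop1 : Set
  Prop1 = ∃[ D ] (Certified D × (∀ v → ¬ Shadowed D v))

  Prop2 : Set
  Prop2 = IsDD2Graph

  Prop3 : Set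
  Prop3 = ∀ s → IsWeakSupport s → ∃[ u ] (Nb s u × ¬ IsLeaf u × ¬ IsSupport u)

-- A certified dominating set without shadowed vertices is exactly a dominating set D whose
-- complement is 2-dominating, so (1) and (2) both say that some D and its complement form a
-- DD₂-pair. In any DD₂-pair every leaf lies in D₂ and every support in D; a weak support then
-- needs a second D₂-neighbour besides its leaf, which is neither a leaf nor a support, giving (3).
-- Conversely, under (3) take D = S ∪ I, where S is the set of supports and I is a maximal
-- independent set among the vertices with no support in their closed neighbourhood: every
-- support has two neighbours outside S (two leaves, or a leaf and the vertex given by (3)),
-- and every vertex of I is a non-leaf all of whose neighbours lie outside S ∪ I.
module Submission where

open import Defs
open import Data.Nat using (ℕ)
open import Data.Bool using (true)
import Data.Bool as Bool
open import Data.Fin using (Fin; _≟_)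
open import Data.Fin.Properties using (any?; all?)
open import Data.Fin.Subset using (Subset; _∈_; _∉_; _⊆_; ∁; ⁅_⁆; _∪_)
open import Data.Fin.Subset.Properties using (_∈?_; ∉⊥; x∈p⇒x∉∁p; x∈∁p⇒x∉p; x∉∁p⇒x∈p; x∉p⇒x∈∁p; x∈⁅x⁆; x∈⁅y⁆⇒x≡y; x∈p∪q⁺; x∈p∪q⁻; q⊆p∪q)
open import Data.Vec using (tabulate)
open import Data.Vec.Properties using ([]=⇒lookup; lookup⇒[]=; lookup∘tabulate)
open import Data.List using (List; []; _∷_; allFin)
open import Data.List.Relation.Unary.Any using (here; there)
open import Data.List.Membership.Propositional using () renaming (_∈_ to _∈ₗ_)
open import Data.List.Membership.Propositional.Properties using (∈-allFin)
open import Data.Product using (_×_; _,_; ∃-syntax; proj₂)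
open import Data.Sum using (_⊎_; inj₁; inj₂; [_,_])
open import Data.Empty using (⊥-elim)
open import Function using (_∘_)
open import Function.Bundles using (_⇔_; mk⇔)
open import Function.Construct.Composition using (_⇔-∘_)
open import Function.Construct.Symmetry using (⇔-sym)
open import Relation.Nullary using (¬_; Dec; yes; no; ¬?)
open import Relation.Nullary.Decidable using (does; dec-true; decidable-stable; _×-dec_; _⊎-dec_; _→-dec_)
open import Relation.Unary using (Decidable)
open import Relation.Binary.PropositionalEquality using (_≡_; _≢_; refl; sym; trans; subst)

subsetOf : ∀ {n} {P : Fin n → Set} → Decidable P → Subset n
subsetOf P? = tabulate (λ v → does (P? v))

∈-subsetOf⁺ : ∀ {n} {P : Fin n → Set} (P? : Decidable P) {v} → P v → v ∈ subsetOf P?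
∈-subsetOf⁺ P? {v} Pv = lookup⇒[]= v _ (trans (lookup∘tabulate _ v) (dec-true (P? v) Pv))

∈-subsetOf⁻ : ∀ {n} {P : Fin n → Set} (P? : Decidable P) {v} → v ∈ subsetOf P? → P v
∈-subsetOf⁻ P? {v} v∈ with P? v | trans (sym (lookup∘tabulate (λ u → does (P? u)) v)) ([]=⇒lookup v∈)
... | yes Pv | _ = Pv
... | no _ | ()

module _ {n : ℕ} (G : Graph n) where
  open Graph G using (adj; irrefl) renaming (sym to adj-sym)

  Nb-sym : ∀ {u v} → Nb G u v → Nb G v u
  Nb-sym {u} {v} uv = trans (adj-sym v u) uv

  Nb-irrefl : ∀ {u v} → Nb G u v → u ≢ v
  Nb-irrefl {u} uv refl with trans (sym uv) (irrefl u)
  ... | ()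

  Nb? : ∀ u v → Dec (Nb G u v)
  Nb? u v = adj u v Bool.≟ true

  leaf? : ∀ v → Dec (IsLeaf G v)
  leaf? v = any? (λ u → Nb? v u ×-dec all? (λ w → Nb? v w →-dec (w ≟ u)))

  support? : ∀ s → Dec (IsSupport G s)
  support? s = any? (λ l → leaf? l ×-dec Nb? s l)

  leaf-neighbour-unique : ∀ {l a b} → IsLeaf G l → Nb G l a → Nb G l b → a ≡ b
  leaf-neighbour-unique (_ , _ , unique) la lb = trans (unique _ la) (sym (unique _ lb))

  leaf-neighbour-isSupport : ∀ {l u} → IsLeaf G l → Nb G l u → IsSupport G u
  leaf-neighbour-isSupport {l} leaf lu = l , leaf , Nb-sym lu

  nonLeaf⇒two-neighbours : NoIsolated G → ∀ {v} → ¬ IsLeaf G v →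
    ∃[ u ] ∃[ w ] (u ≢ w × Nb G v u × Nb G v w)
  nonLeaf⇒two-neighbours noIso {v} ¬leaf with noIso v
  ... | u , vu with any? (λ w → Nb? v w ×-dec ¬? (w ≟ u))
  ... | yes (w , vw , w≢u) = w , u , w≢u , vw , vu
  ... | no none = ⊥-elim (¬leaf (u , vu , λ w vw → decidable-stable (w ≟ u) (λ w≢u → none (w , vw , w≢u))))

  strongSupport⇒other-leaf : ∀ {s} → IsStrongSupport G s → ∀ l →
    ∃[ l′ ] (l′ ≢ l × IsLeaf G l′ × Nb G s l′)
  strongSupport⇒other-leaf (a , b , a≢b , leafa , leafb , sa , sb) l with a ≟ l
  ... | yes refl = b , a≢b ∘ sym , leafb , sb
  ... | no a≢l = a , a≢l , leafa , sa

  Dominating-mono : ∀ {D D′} → D ⊆ D′ → Dominating G D → Dominating G D′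
  Dominating-mono D⊆D′ dom v v∉D′ with dom v (v∉D′ ∘ D⊆D′)
  ... | u , u∈D , vu = u , D⊆D′ u∈D , vu

  TwoDominating-mono : ∀ {D D′} → D ⊆ D′ → TwoDominating G D → TwoDominating G D′
  TwoDominating-mono D⊆D′ two v v∉D′ with two v (v∉D′ ∘ D⊆D′)
  ... | u , w , u≢w , u∈D , w∈D , vu , vw = u , w , u≢w , D⊆D′ u∈D , D⊆D′ w∈D , vu , vw

  Disjoint-∁ : ∀ D → Disjoint G D (∁ D)
  Disjoint-∁ D v = x∈p⇒x∉∁p

  Disjoint⇒⊆∁ : ∀ {D D₂} → Disjoint G D D₂ → D ⊆ ∁ D₂
  Disjoint⇒⊆∁ disj {v} v∈D = x∉p⇒x∈∁p (disj v v∈D)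

  DD2Pair⇒∁DD2Pair : ∀ {D D₂} → DD2Pair G D D₂ → DD2Pair G (∁ D₂) (∁ (∁ D₂))
  DD2Pair⇒∁DD2Pair {D₂ = D₂} (disj , dom , two) =
    Disjoint-∁ (∁ D₂) , Dominating-mono (Disjoint⇒⊆∁ disj) dom , TwoDominating-mono (x∉p⇒x∈∁p ∘ x∈p⇒x∉∁p) two

  Prop2⇔∁DD2Pair : Prop2 G ⇔ (∃[ D ] DD2Pair G D (∁ D))
  Prop2⇔∁DD2Pair = mk⇔ (λ (_ , D₂ , pair) → ∁ D₂ , DD2Pair⇒∁DD2Pair pair) (λ (D , pair) → D , ∁ D , pair)

  Prop1⇔∁DD2Pair : Prop1 G ⇔ (∃[ D ] DD2Pair G D (∁ D))
  Prop1⇔∁DD2Pair = mk⇔ to from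
    where
    to : Prop1 G → ∃[ D ] DD2Pair G D (∁ D)
    to (D , (dom , cert) , ¬shadowed) = D , Disjoint-∁ D , dom , two
      where
      two : TwoDominating G (∁ D)
      two v v∉∁D with cert v (x∉∁p⇒x∈p v∉∁D)
      ... | inj₁ closed = ⊥-elim (¬shadowed v (x∉∁p⇒x∈p v∉∁D , closed))
      ... | inj₂ (u , w , u≢w , u∉D , w∉D , vu , vw) = u , w , u≢w , x∉p⇒x∈∁p u∉D , x∉p⇒x∈∁p w∉D , vu , vw
    from : ∃[ D ] DD2Pair G D (∁ D) → Prop1 G
    from (D , _ , dom , two) = D , (dom , λ v v∈D → inj₂ (outside v∈D)) , ¬shadowed
      where
      outside : ∀ {v} → v ∈ D → ∃[ u ] ∃[ w ] (u ≢ w × u ∉ D × w ∉ D × Nb G v u × Nb G v w)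
      outside {v} v∈D with two v (x∈p⇒x∉∁p v∈D)
      ... | u , w , u≢w , u∈∁D , w∈∁D , vu , vw = u , w , u≢w , x∈∁p⇒x∉p u∈∁D , x∈∁p⇒x∉p w∈∁D , vu , vw
      ¬shadowed : ∀ v → ¬ Shadowed G D v
      ¬shadowed v (v∈D , closed) with outside v∈D
      ... | u , _ , _ , u∉D , _ , vu , _ = u∉D (closed u vu)

  DD2Pair⇒leaf∈D₂ : ∀ {D D₂ l} → DD2Pair G D D₂ → IsLeaf G l → l ∈ D₂
  DD2Pair⇒leaf∈D₂ {D₂ = D₂} {l} (_ , _ , two) leaf with l ∈? D₂
  ... | yes l∈D₂ = l∈D₂
  ... | no l∉D₂ with two l l∉D₂
  ... | _ , _ , u≢w , _ , _ , lu , lw = ⊥-elim (u≢w (leaf-neighbour-unique leaf lu lw))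

  DD2Pair⇒support∈D : ∀ {D D₂ l s} → DD2Pair G D D₂ → IsLeaf G l → Nb G s l → s ∈ D
  DD2Pair⇒support∈D {D} {l = l} pair@(disj , dom , _) leaf sl
    with dom l (λ l∈D → disj l l∈D (DD2Pair⇒leaf∈D₂ pair leaf))
  ... | u , u∈D , lu = subst (_∈ D) (leaf-neighbour-unique leaf lu (Nb-sym sl)) u∈D

  DD2Pair⇒support∉D₂ : ∀ {D D₂ s} → DD2Pair G D D₂ → IsSupport G s → s ∉ D₂
  DD2Pair⇒support∉D₂ pair@(disj , _ , _) (_ , leaf , sl) = disj _ (DD2Pair⇒support∈D pair leaf sl)

  Prop2⇒Prop3 : Prop2 G → Prop3 G
  Prop2⇒Prop3 (D , D₂ , pair@(disj , _ , two)) s ((l , leaf , sl) , ¬strong)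
    with two s (disj s (DD2Pair⇒support∈D pair leaf sl))
  ... | u , w , u≢w , u∈D₂ , w∈D₂ , su , sw with leaf? u | leaf? w
  ...   | no ¬leafu | _ = u , su , ¬leafu , (λ supu → DD2Pair⇒support∉D₂ pair supu u∈D₂)
  ...   | yes _ | no ¬leafw = w , sw , ¬leafw , (λ supw → DD2Pair⇒support∉D₂ pair supw w∈D₂)
  ...   | yes leafu | yes leafw = ⊥-elim (¬strong (u , w , u≢w , leafu , leafw , su , sw))

  Independent : Subset n → Set
  Independent I = ∀ {u v} → u ∈ I → v ∈ I → ¬ Nb G u v

  IndependentIn : (Fin n → Set) → Subset n → Set
  IndependentIn P I = (∀ {v} → v ∈ I → P v) × Independent I

  Dominates : Subset n → Fin n → Set
  Dominates I v = v ∈ I ⊎ ∃[ u ] (u ∈ I × Nb G v u)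

  Dominates-mono : ∀ {I J v} → I ⊆ J → Dominates I v → Dominates J v
  Dominates-mono I⊆J (inj₁ v∈I) = inj₁ (I⊆J v∈I)
  Dominates-mono I⊆J (inj₂ (u , u∈I , vu)) = inj₂ (u , I⊆J u∈I , vu)

  IndependentIn-insert : ∀ {P I x} → IndependentIn P I → P x → (∀ {u} → u ∈ I → ¬ Nb G x u) →
    IndependentIn P (⁅ x ⁆ ∪ I)
  IndependentIn-insert {P} {I} {x} (I⊆P , indep) Px x∤I = ⊆P , indep′
    where
    cases : ∀ {v} → v ∈ ⁅ x ⁆ ∪ I → v ≡ x ⊎ v ∈ I
    cases v∈ with x∈p∪q⁻ ⁅ x ⁆ I v∈
    ... | inj₁ v∈⁅x⁆ = inj₁ (x∈⁅y⁆⇒x≡y x v∈⁅x⁆)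
    ... | inj₂ v∈I = inj₂ v∈I
    ⊆P : ∀ {v} → v ∈ ⁅ x ⁆ ∪ I → P v
    ⊆P v∈ with cases v∈
    ... | inj₁ refl = Px
    ... | inj₂ v∈I = I⊆P v∈I
    indep′ : Independent (⁅ x ⁆ ∪ I)
    indep′ u∈ v∈ with cases u∈ | cases v∈
    ... | inj₁ refl | inj₁ refl = λ xx → Nb-irrefl xx refl
    ... | inj₁ refl | inj₂ v∈I = x∤I v∈I
    ... | inj₂ u∈I | inj₁ refl = x∤I u∈I ∘ Nb-sym
    ... | inj₂ u∈I | inj₂ v∈I = indep u∈I v∈I

  greedyStep : ∀ {P I} → Decidable P → ∀ x → IndependentIn P I →
    ∃[ I₁ ] (I ⊆ I₁ × IndependentIn P I₁ × (P x → Dominates I₁ x))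
  greedyStep {I = I} P? x indep with any? (λ u → u ∈? I ×-dec Nb? x u) | P? x
  ... | yes (u , u∈I , xu) | _ = I , (λ v∈I → v∈I) , indep , λ _ → inj₂ (u , u∈I , xu)
  ... | no x∤I | yes Px =
          ⁅ x ⁆ ∪ I , q⊆p∪q ⁅ x ⁆ I , IndependentIn-insert indep Px (λ {u} u∈I xu → x∤I (u , u∈I , xu)) ,
          λ _ → inj₁ (x∈p∪q⁺ (inj₁ (x∈⁅x⁆ x)))
  ... | no _ | no ¬Px = I , (λ v∈I → v∈I) , indep , ⊥-elim ∘ ¬Px

  greedyIndependentExtension : ∀ {P I} → Decidable P → (xs : List (Fin n)) → IndependentIn P I →
    ∃[ J ] (I ⊆ J × IndependentIn P J × (∀ {v} → v ∈ₗ xs → P v → Dominates J v))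
  greedyIndependentExtension {I = I} P? [] indep = I , (λ v∈I → v∈I) , indep , λ ()
  greedyIndependentExtension P? (x ∷ xs) indep with greedyStep P? x indep
  ... | I₁ , I⊆I₁ , indep₁ , dominatesX with greedyIndependentExtension P? xs indep₁
  ...   | J , I₁⊆J , indepJ , dominatesXs = J , (λ v∈I → I₁⊆J (I⊆I₁ v∈I)) , indepJ ,
            λ { (here refl) Px → Dominates-mono I₁⊆J (dominatesX Px) ; (there v∈xs) → dominatesXs v∈xs }

  maximalIndependentIn : ∀ {P} → Decidable P → ∃[ I ] (IndependentIn P I × (∀ v → P v → Dominates I v))
  maximalIndependentIn P?
    with greedyIndependentExtension P? (allFin n) ((λ v∈⊥ → ⊥-elim (∉⊥ v∈⊥)) , λ u∈⊥ → ⊥-elim (∉⊥ u∈⊥))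
  ... | I , _ , indep , dominates = I , indep , λ v → dominates (∈-allFin v)

  Prop3⇒leaf-not-support : Prop3 G → ∀ {l} → IsLeaf G l → ¬ IsSupport G l
  Prop3⇒leaf-not-support p3 {l} leaf (l₂ , leaf₂ , ll₂) with p3 l₂ ((l , leaf , Nb-sym ll₂) , ¬strong)
    where
    ¬strong : ¬ IsStrongSupport G l₂
    ¬strong (_ , _ , a≢b , _ , _ , l₂a , l₂b) = a≢b (leaf-neighbour-unique leaf₂ l₂a l₂b)
  ... | u , l₂u , ¬leafu , _ = ¬leafu (subst (IsLeaf G) (leaf-neighbour-unique leaf₂ (Nb-sym ll₂) l₂u) leaf)

  Prop3⇒support-two-nonSupport-neighbours : Prop3 G → ∀ {s} → IsSupport G s →
    ∃[ u ] ∃[ w ] (u ≢ w × ¬ IsSupport G u × ¬ IsSupport G w × Nb G s u × Nb G s w)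
  Prop3⇒support-two-nonSupport-neighbours p3 {s} sup@(l , leaf , sl)
    with any? (λ w → Nb? s w ×-dec ¬? (w ≟ l) ×-dec ¬? (support? w))
  ... | yes (w , sw , w≢l , ¬supw) = l , w , w≢l ∘ sym , Prop3⇒leaf-not-support p3 leaf , ¬supw , sl , sw
  ... | no none with p3 s (sup , none ∘ otherLeaf)
    where
    otherLeaf : IsStrongSupport G s → ∃[ w ] (Nb G s w × w ≢ l × ¬ IsSupport G w)
    otherLeaf strong with strongSupport⇒other-leaf strong l
    ... | l′ , l′≢l , leaf′ , sl′ = l′ , sl′ , l′≢l , Prop3⇒leaf-not-support p3 leaf′
  ...   | u , su , ¬leafu , ¬supu = ⊥-elim (none (u , su , (λ { refl → ¬leafu leaf }) , ¬supu))

  FarFromSupports : Fin n → Set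
  FarFromSupports v = ¬ IsSupport G v × (∀ u → Nb G v u → ¬ IsSupport G u)

  farFromSupports? : ∀ v → Dec (FarFromSupports v)
  farFromSupports? v = ¬? (support? v) ×-dec all? (λ u → Nb? v u →-dec ¬? (support? u))

  module SupportsAndMaximalIndependent (noIso : NoIsolated G) (p3 : Prop3 G) {I : Subset n}
    (I⊆far : ∀ {v} → v ∈ I → FarFromSupports v) (indep : Independent I)
    (maximal : ∀ v → FarFromSupports v → Dominates I v) where

    support-or-∈I? : ∀ v → Dec (IsSupport G v ⊎ v ∈ I)
    support-or-∈I? v = support? v ⊎-dec v ∈? I

    D : Subset n
    D = subsetOf support-or-∈I?

    nonSupport∉I⇒∈∁D : ∀ {u} → ¬ IsSupport G u → u ∉ I → u ∈ ∁ D
    nonSupport∉I⇒∈∁D ¬sup u∉I = x∉p⇒x∈∁p ([ ¬sup , u∉I ] ∘ ∈-subsetOf⁻ support-or-∈I?)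

    ∈I⇒noSupportNeighbour : ∀ {v u} → v ∈ I → Nb G v u → ¬ IsSupport G u
    ∈I⇒noSupportNeighbour v∈I vu = proj₂ (I⊆far v∈I) _ vu

    nonSupport-nearSupport⇒∈∁D : ∀ {s u} → IsSupport G s → Nb G s u → ¬ IsSupport G u → u ∈ ∁ D
    nonSupport-nearSupport⇒∈∁D sup su ¬supu =
      nonSupport∉I⇒∈∁D ¬supu (λ u∈I → ∈I⇒noSupportNeighbour u∈I (Nb-sym su) sup)

    dominating : Dominating G D
    dominating v v∉D with any? (λ u → Nb? v u ×-dec support? u)
    ... | yes (u , vu , supu) = u , ∈-subsetOf⁺ support-or-∈I? (inj₁ supu) , vu
    ... | no noSupport
      with maximal v ((v∉D ∘ ∈-subsetOf⁺ support-or-∈I? ∘ inj₁) , λ u vu supu → noSupport (u , vu , supu))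
    ...   | inj₁ v∈I = ⊥-elim (v∉D (∈-subsetOf⁺ support-or-∈I? (inj₂ v∈I)))
    ...   | inj₂ (u , u∈I , vu) = u , ∈-subsetOf⁺ support-or-∈I? (inj₂ u∈I) , vu

    TwoOutside : Fin n → Set
    TwoOutside v = ∃[ u ] ∃[ w ] (u ≢ w × u ∈ ∁ D × w ∈ ∁ D × Nb G v u × Nb G v w)

    support⇒twoOutside : ∀ {v} → IsSupport G v → TwoOutside v
    support⇒twoOutside sup with Prop3⇒support-two-nonSupport-neighbours p3 sup
    ... | u , w , u≢w , ¬supu , ¬supw , vu , vw =
          u , w , u≢w , nonSupport-nearSupport⇒∈∁D sup vu ¬supu , nonSupport-nearSupport⇒∈∁D sup vw ¬supw , vu , vw

    ∈I⇒neighbour∈∁D : ∀ {v u} → v ∈ I → Nb G v u → u ∈ ∁ D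
    ∈I⇒neighbour∈∁D v∈I vu = nonSupport∉I⇒∈∁D (∈I⇒noSupportNeighbour v∈I vu) (λ u∈I → indep v∈I u∈I vu)

    ∈I⇒twoOutside : ∀ {v} → v ∈ I → TwoOutside v
    ∈I⇒twoOutside v∈I with nonLeaf⇒two-neighbours noIso
      (λ { leaf@(_ , vu , _) → ∈I⇒noSupportNeighbour v∈I vu (leaf-neighbour-isSupport leaf vu) })
    ... | u , w , u≢w , vu , vw = u , w , u≢w , ∈I⇒neighbour∈∁D v∈I vu , ∈I⇒neighbour∈∁D v∈I vw , vu , vw

    twoDominating : TwoDominating G (∁ D)
    twoDominating v v∉∁D =
      [ (λ sup → support⇒twoOutside sup) , (λ v∈I → ∈I⇒twoOutside v∈I) ]
        (∈-subsetOf⁻ support-or-∈I? (x∉∁p⇒x∈p v∉∁D))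

  Prop3⇒Prop2 : NoIsolated G → Prop3 G → Prop2 G
  Prop3⇒Prop2 noIso p3 with maximalIndependentIn farFromSupports?
  ... | I , (I⊆far , indep) , maximal = D , ∁ D , Disjoint-∁ D , dominating , twoDominating
    where open SupportsAndMaximalIndependent noIso p3 I⊆far indep maximal

mainTheorem3 : (n : ℕ) (G : Graph n) → NoIsolated G →
    (Prop1 G ⇔ Prop2 G) × (Prop2 G ⇔ Prop3 G)
mainTheorem3 n G noIso =
  ⇔-sym (Prop2⇔∁DD2Pair G) ⇔-∘ Prop1⇔∁DD2Pair G ,
  mk⇔ (Prop2⇒Prop3 G) (Prop3⇒Prop2 G noIso)
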